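{- For any positive integers $n$ and $p$, there is a decision tree processing strings of length $n$ that finds all $p$-periodic runs and has basic height at most $2\lceil n/p\rceil$.
   Context: Strings are over a totally ordered alphabet; $t[i..j]=t[i]\cdots t[j]$. An integer $q$ is a period of a string $w$ if $0<q<|w|$ and $w[i]=w[i+q]$ for $i=1,\ldots,|w|-q$; the minimal period is the least one. A run of a string $t$ is a substring $t[i..j]$ with $|t[i..j]|\ge 2q$ for its minimal period $q$, such that each of $t[i-1..j]$ and $t[i..j+1]$, whenever defined, has strictly greater minimal period than $t[i..j]$. A run $r$ is $p$-periodic if $2p\le |r|$ and $p$ is a (not necessarily minimal) period of $r$. A decision tree processing strings of length $n$ is a rooted ternary tree whose interior vertices are labeled with pairs $(i,j)$, $1\le i,j\le n$, with outgoing edges labeled $<,=,>$; a string $t$ of length $n$ reaches a vertex if along the path from the root every vertex labeled $(i,j)$ is left via the edge labeled by the actual relation between $t[i]$ and $t[j]$. The basic height is the minimal $k$ such that every root-to-leaf path has at most $k$ edges labeled $<$ or $>$. A decision tree processing strings of length $n$ finds all runs with a property $P$ if for any strings $t_1,t_2$ of length $n$ reaching the same leaf, and all $i,j\in\{1,\ldots,n\}$, $t_1[i..j]$ is a run satisfying $P$ iff $t_2[i..j]$ is a run satisfying $P$. -}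

module Defs where

open import Level using (Level; _⊔_)
open import Data.Nat using (ℕ; zero; suc; _+_; _*_; _∸_; _≤_; _<_; NonZero)
open import Data.Nat.DivMod using (_/_)
open import Data.Fin using (Fin; toℕ)
open import Data.Product using (Σ; _×_; ∃)
open import Data.Sum using (_⊎_)
open import Relation.Binary.Bundles using (StrictTotalOrder)
open import Relation.Binary.PropositionalEquality using (_≡_)
open import Function.Bundles using (_⇔_)

⌈_/_⌉ : (n p : ℕ) → .{{NonZero p}} → ℕ
⌈ n / p ⌉ = (n + p ∸ 1) / p

-- Decision trees processing strings of length n.
-- node i j L E G : compare t[i] with t[j]; L / E / G are the subtrees
-- for the outgoing edges labelled < , = , >.
-- Positions are 0-based (Fin n) instead of 1..n.
data DTree (n : ℕ) : Set where
  leaf : DTree n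
  node : Fin n → Fin n → DTree n → DTree n → DTree n → DTree n

basicHeight : ∀ {n} → DTree n → ℕ
basicHeight leaf = 0
basicHeight (node i j L E G) =
  Data.Nat._⊔_ (suc (basicHeight L)) (Data.Nat._⊔_ (basicHeight E) (suc (basicHeight G)))

data Leaf {n : ℕ} : DTree n → Set where
  here : Leaf leaf
  viaL : ∀ {i j L E G} → Leaf L → Leaf (node i j L E G)
  viaE : ∀ {i j L E G} → Leaf E → Leaf (node i j L E G)
  viaG : ∀ {i j L E G} → Leaf G → Leaf (node i j L E G)

module _ {a ℓ₁ ℓ₂ : Level} (A : StrictTotalOrder a ℓ₁ ℓ₂) where
  open StrictTotalOrder A renaming (Carrier to Char; _<_ to _≺_)

  Str : ℕ → Set a
  Str n = Fin n → Char

  data Reaches {n : ℕ} (t : Str n) : (T : DTree n) → Leaf T → Set (a ⊔ ℓ₁ ⊔ ℓ₂) where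
    r-here : Reaches t leaf here
    r-L : ∀ {i j L E G v} → t i ≺ t j → Reaches t L v → Reaches t (node i j L E G) (viaL v)
    r-E : ∀ {i j L E G v} → t i ≈ t j → Reaches t E v → Reaches t (node i j L E G) (viaE v)
    r-G : ∀ {i j L E G v} → t j ≺ t i → Reaches t G v → Reaches t (node i j L E G) (viaG v)

  -- Substrings t[i..j] are given by 0-based inclusive bounds i j : ℕ;
  -- their length is (suc j ∸ i).
  -- q is a period of t[i..j]: 0 < q < |t[i..j]| and w[k] = w[k+q].
  IsPeriod : ∀ {n} → Str n → (i j q : ℕ) → Set ℓ₁
  IsPeriod {n} t i j q =
    (0 < q) × (q < suc j ∸ i) ×
    (∀ (k l : Fin n) → i ≤ toℕ k → toℕ l ≡ toℕ k + q → toℕ l ≤ j → t k ≈ t l)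

  IsMinPeriod : ∀ {n} → Str n → (i j q : ℕ) → Set ℓ₁
  IsMinPeriod t i j q = IsPeriod t i j q × (∀ q′ → IsPeriod t i j q′ → q ≤ q′)

  IsRun : ∀ {n} → Str n → (i j : ℕ) → Set ℓ₁
  IsRun {n} t i j = ∃ λ q →
    IsMinPeriod t i j q × (2 * q ≤ suc j ∸ i) ×
    (1 ≤ i → ∀ q′ → IsMinPeriod t (i ∸ 1) j q′ → q < q′) ×
    (suc j < n → ∀ q′ → IsMinPeriod t i (suc j) q′ → q < q′)

  IsPPeriodicRun : ∀ {n} → ℕ → Str n → (i j : ℕ) → Set ℓ₁
  IsPPeriodicRun p t i j = IsRun t i j × (2 * p ≤ suc j ∸ i) × IsPeriod t i j p

  FindsPPeriodicRuns : ∀ {n} → ℕ → DTree n → Set (a ⊔ ℓ₁ ⊔ ℓ₂)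
  FindsPPeriodicRuns {n} p T =
    ∀ (t₁ t₂ : Str n) (v : Leaf T) → Reaches t₁ T v → Reaches t₂ T v →
    ∀ (i j : Fin n) → IsPPeriodicRun p t₁ (toℕ i) (toℕ j) ⇔ IsPPeriodicRun p t₂ (toℕ i) (toℕ j)

module Submission where

-- Write PMatch t x for t[x] = t[x+p]. A Fine–Wilf step (periods q ≤ p of a window of length
-- at least p + q give the period p − q) shows that t[i..j] is a p-periodic run iff it has length
-- at least 2p, has period p, and PMatch fails at the two positions i − 1 and j + 1 − p where a
-- one-letter extension would be tested. Every window of length ≥ 2p contains a whole block
-- [kp, kp + p). For each block the tree compares t[x] with t[x+p] for x = kp − 1, kp − 2, ...
-- and for x = kp, kp + 1, ..., each scan continuing only on "=", so a block contributes at most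
-- two strict edges. Two strings reaching the same leaf then agree on PMatch along the
-- maximal p-periodic stretch around every block including both boundary positions, which is
-- all the characterization of runs looks at.

open import Defs
open import Level using (Level; _⊔_)
open import Data.Unit.Polymorphic using (⊤)
open import Data.Empty using (⊥-elim)
open import Function using (_∘_)
open import Data.Nat using (ℕ; zero; suc; _+_; _*_; _∸_; _≤_; _<_; z≤n; s≤s; s≤s⁻¹; _<?_; _≤?_; NonZero; >-nonZero⁻¹)
open import Data.Nat.Properties
open import Data.Nat.Induction using (<-rec)
open import Data.Nat.DivMod using (_/_; m*n/n≡m; /-monoˡ-≤)
open import Data.Nat.Tactic.RingSolver using (solve)
open import Data.Fin using (Fin; toℕ; fromℕ<)
open import Data.Fin.Properties using (toℕ-fromℕ<; toℕ-injective; toℕ<n; all?)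
open import Data.Product using (Σ; _×_; _,_; proj₁; proj₂)
open import Data.List using (List; _∷_; []; downFrom; iterate)
open import Data.Sum using (_⊎_; inj₁; inj₂)
open import Function.Bundles using (_⇔_; mk⇔; Equivalence)
open import Relation.Nullary using (¬_; Dec; yes; no; contradiction)
open import Relation.Nullary.Decidable using (_×-dec_; _→-dec_)
open import Relation.Unary using (Pred; Decidable)
open import Relation.Binary.Bundles using (StrictTotalOrder)
open import Relation.Binary.PropositionalEquality

minimalWitness : ∀ {ℓ} {P : Pred ℕ ℓ} → Decidable P → ∀ {m} → P m →
                 Σ ℕ λ q → P q × (∀ q′ → P q′ → q ≤ q′)
minimalWitness {ℓ} {P} P? = <-rec (λ m → P m → Least) search _
  where
  Least : Set ℓ
  Least = Σ ℕ λ q → P q × (∀ q′ → P q′ → q ≤ q′)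
  search : ∀ m → (∀ {k} → k < m → P k → Least) → P m → Least
  search m smaller Pm with anyUpTo? P? m
  ... | yes (k , k<m , Pk) = smaller k<m Pk
  ... | no nothingBelow = m , Pm , λ q′ Pq′ → ≮⇒≥ (λ q′<m → nothingBelow (q′ , q′<m , Pq′))

module Periods {a ℓ₁ ℓ₂ : Level} (A : StrictTotalOrder a ℓ₁ ℓ₂) (n : ℕ) where
  open StrictTotalOrder A using (_≈_; module Eq) renaming (_≟_ to _≟ᶜ_)

  -- Positions outside the string match vacuously.
  Match : Str A n → ℕ → ℕ → Set ℓ₁
  Match t x y = ∀ (k l : Fin n) → toℕ k ≡ x → toℕ l ≡ y → t k ≈ t l

  HasPeriod : Str A n → (i j q : ℕ) → Set ℓ₁
  HasPeriod t i j q = ∀ x → i ≤ x → x + q ≤ j → Match t x (x + q)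

  module _ {t : Str A n} where

    match-sym : ∀ {x y} → Match t x y → Match t y x
    match-sym x≈y k l k≡y l≡x = Eq.sym (x≈y l k l≡x k≡y)

    match-trans : ∀ {x y z} → y < n → Match t x y → Match t y z → Match t x z
    match-trans y<n x≈y y≈z k l k≡x l≡z =
      Eq.trans (x≈y k (fromℕ< y<n) k≡x (toℕ-fromℕ< y<n)) (y≈z (fromℕ< y<n) l (toℕ-fromℕ< y<n) l≡z)

    match⇔≈ : ∀ {x y} (x<n : x < n) (y<n : y < n) → Match t x y ⇔ t (fromℕ< x<n) ≈ t (fromℕ< y<n)
    match⇔≈ x<n y<n = mk⇔ (λ x≈y → x≈y _ _ (toℕ-fromℕ< x<n) (toℕ-fromℕ< y<n))
      λ x≈y k l k≡x l≡y → subst₂ (λ k l → t k ≈ t l) (sym (at x<n k≡x)) (sym (at y<n l≡y)) x≈y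
      where
      at : ∀ {k z} (z<n : z < n) → toℕ k ≡ z → k ≡ fromℕ< z<n
      at z<n k≡z = toℕ-injective (trans k≡z (sym (toℕ-fromℕ< z<n)))

    match-outOfRange : ∀ {x y} → n ≤ y → Match t x y
    match-outOfRange n≤y _ l _ refl = contradiction (toℕ<n l) (≤⇒≯ n≤y)

    isPeriod⇒hasPeriod : ∀ {i j q} → IsPeriod A t i j q → HasPeriod t i j q
    isPeriod⇒hasPeriod (_ , _ , period) x i≤x x+q≤j k l refl l≡x+q =
      period k l i≤x l≡x+q (subst (_≤ _) (sym l≡x+q) x+q≤j)

    hasPeriod⇒isPeriod : ∀ {i j q} → 0 < q → q < suc j ∸ i → HasPeriod t i j q → IsPeriod A t i j q
    hasPeriod⇒isPeriod 0<q q<len period = 0<q , q<len , λ k l i≤k l≡k+q l≤j →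
      period (toℕ k) i≤k (subst (_≤ _) l≡k+q l≤j) k l refl l≡k+q

    isPeriod? : ∀ i j q → Dec (IsPeriod A t i j q)
    isPeriod? i j q = (0 <? q) ×-dec (q <? suc j ∸ i) ×-dec
      all? λ k → all? λ l → (i ≤? toℕ k) →-dec (toℕ l ≟ toℕ k + q) →-dec (toℕ l ≤? j) →-dec (t k ≟ᶜ t l)

    minPeriod : ∀ {i j q} → IsPeriod A t i j q → Σ ℕ (IsMinPeriod A t i j)
    minPeriod = minimalWitness (isPeriod? _ _)

    periodBelowMinPeriods : ∀ {i j q} → IsPeriod A t i j q → ¬ (∀ q′ → IsMinPeriod A t i j q′ → q < q′)
    periodBelowMinPeriods q-period below with minPeriod q-period
    ... | q′ , q′-min@(_ , q′-least) = <⇒≱ (below q′ q′-min) (q′-least _ q-period)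

    hasPeriod-mono : ∀ {i i′ j j′ q} → i ≤ i′ → j′ ≤ j → HasPeriod t i j q → HasPeriod t i′ j′ q
    hasPeriod-mono i≤i′ j′≤j period x i′≤x x+q≤j′ = period x (≤-trans i≤i′ i′≤x) (≤-trans x+q≤j′ j′≤j)

    hasPeriod-extendˡ : ∀ {c j q} → Match t c (c + q) → HasPeriod t (suc c) j q → HasPeriod t c j q
    hasPeriod-extendˡ {c} c≈c+q period x c≤x x+q≤j with m≤n⇒m<n∨m≡n c≤x
    ... | inj₁ c<x = period x c<x x+q≤j
    ... | inj₂ refl = c≈c+q

    hasPeriod-extendʳ : ∀ {i j q e} → e + q ≡ suc j → Match t e (suc j) → HasPeriod t i j q → HasPeriod t i (suc j) q
    hasPeriod-extendʳ {j = j} {q} {e} e+q≡ e≈ period x i≤x x+q≤1+j with x + q ≤? j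
    ... | yes x+q≤j = period x i≤x x+q≤j
    ... | no x+q≰j with +-cancelʳ-≡ q x e (trans (≤-antisym x+q≤1+j (≰⇒> x+q≰j)) (sym e+q≡))
    ...   | refl = subst (Match t e) (sym e+q≡) e≈

    -- The subtraction step of the Fine–Wilf theorem.
    periodDifference : ∀ {i j q d} → j < n → i + (q + d) + q ≤ suc j →
                       HasPeriod t i j (q + d) → HasPeriod t i j q → HasPeriod t i j d
    periodDifference {i} {j} {q} {d} j<n long q+d-period q-period x i≤x x+d≤j with x + (q + d) ≤? j
    ... | yes fits = match-trans (≤-<-trans fits j<n) (q+d-period x i≤x fits) (match-sym x+d≈)
      where
      x+d+q≡ : x + d + q ≡ x + (q + d)
      x+d+q≡ = solve (x ∷ q ∷ d ∷ [])
      x+d≈ : Match t (x + d) (x + (q + d))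
      x+d≈ = subst (Match t (x + d)) x+d+q≡
               (q-period (x + d) (≤-trans i≤x (m≤m+n x d)) (subst (_≤ j) (sym x+d+q≡) fits))
    ... | no overhangs = subst₂ (Match t) (m∸n+n≡m q≤x) y+[q+d]≡ (match-trans y<n (match-sym y≈x) y≈x+d)
      where
      i+q≤x : i + q ≤ x
      i+q≤x = +-cancelʳ-≤ (q + d) (i + q) x
                (≤-trans (≤-reflexive i+q+[q+d]≡) (≤-trans long (≰⇒> overhangs)))
        where
        i+q+[q+d]≡ : i + q + (q + d) ≡ i + (q + d) + q
        i+q+[q+d]≡ = solve (i ∷ q ∷ d ∷ [])
      q≤x : q ≤ x
      q≤x = ≤-trans (m≤n+m q i) i+q≤x
      y : ℕ
      y = x ∸ q
      y+[q+d]≡ : y + (q + d) ≡ x + d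
      y+[q+d]≡ = trans (sym (+-assoc y q d)) (cong (_+ d) (m∸n+n≡m q≤x))
      i≤y : i ≤ y
      i≤y = m+n≤o⇒m≤o∸n i i+q≤x
      y<n : y < n
      y<n = ≤-<-trans (m∸n≤m x q) (≤-<-trans (≤-trans (m≤m+n x d) x+d≤j) j<n)
      y≈x : Match t y (y + q)
      y≈x = q-period y i≤y (subst (_≤ j) (sym (m∸n+n≡m q≤x)) (≤-trans (m≤m+n x d) x+d≤j))
      y≈x+d : Match t y (y + (q + d))
      y≈x+d = q+d-period y i≤y (subst (_≤ j) (sym y+[q+d]≡) x+d≤j)

    extendˡ-iff : ∀ {c j p q} → j < n → suc c + p + q ≤ suc j → 0 < q → q ≤ p →
                  HasPeriod t (suc c) j p → HasPeriod t (suc c) j q → HasPeriod t c j q ⇔ Match t c (c + p)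
    extendˡ-iff {c} {j} {p} {q} j<n long 0<q q≤p p-period q-period with m≤n⇒∃[o]m+o≡n q≤p
    ... | d , refl = mk⇔ (λ extended → match-trans c+q<n (extended c ≤-refl c+q≤j) c+q≈c+p)
                         (λ c≈c+p → hasPeriod-extendˡ (match-trans c+p<n c≈c+p (match-sym c+q≈c+p)) q-period)
      where
      c+p≤j : c + (q + d) ≤ j
      c+p≤j = s≤s⁻¹ (≤-trans (m≤m+n (suc c + (q + d)) q) long)
      c+q≤j : c + q ≤ j
      c+q≤j = ≤-trans (+-monoʳ-≤ c (m≤m+n q d)) c+p≤j
      c+p<n : c + (q + d) < n
      c+p<n = ≤-<-trans c+p≤j j<n
      c+q<n : c + q < n
      c+q<n = ≤-<-trans c+q≤j j<n
      c+q≈c+p : Match t (c + q) (c + (q + d))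
      c+q≈c+p = subst (Match t (c + q)) (+-assoc c q d)
        (periodDifference j<n long p-period q-period (c + q) (m<m+n c 0<q)
          (subst (_≤ j) (sym (+-assoc c q d)) c+p≤j))

    extendʳ-iff : ∀ {i j p q c} → j < n → i + p + q ≤ suc j → 0 < q → q ≤ p → c + p ≡ suc j →
                  HasPeriod t i j p → HasPeriod t i j q → HasPeriod t i (suc j) q ⇔ Match t c (suc j)
    extendʳ-iff {i} {j} {p} {q} {c} j<n long 0<q q≤p c+p≡ p-period q-period with m≤n⇒∃[o]m+o≡n q≤p
    ... | d , refl = mk⇔ (λ extended → match-trans c+d<n c≈c+d
                                         (subst (Match t (c + d)) c+d+q≡ (extended (c + d) i≤c+d (≤-reflexive c+d+q≡))))
                         (λ c≈ → hasPeriod-extendʳ c+d+q≡ (match-trans c<n (match-sym c≈c+d) c≈) q-period)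
      where
      c+d+q≡ : c + d + q ≡ suc j
      c+d+q≡ = trans (trans (+-assoc c d q) (cong (c +_) (+-comm d q))) c+p≡
      c+d≤j : c + d ≤ j
      c+d≤j = s≤s⁻¹ (subst (c + d <_) c+d+q≡ (m<m+n (c + d) 0<q))
      c+d<n : c + d < n
      c+d<n = ≤-<-trans c+d≤j j<n
      c<n : c < n
      c<n = ≤-<-trans (m≤m+n c d) c+d<n
      i≤c : i ≤ c
      i≤c = +-cancelʳ-≤ (q + d) i c (≤-trans (m≤m+n (i + (q + d)) q) (subst (i + (q + d) + q ≤_) (sym c+p≡) long))
      i≤c+d : i ≤ c + d
      i≤c+d = ≤-trans i≤c (m≤m+n c d)
      c≈c+d : Match t c (c + d)
      c≈c+d = periodDifference j<n long p-period q-period c i≤c c+d≤j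

module PeriodicRuns {a ℓ₁ ℓ₂ : Level} (A : StrictTotalOrder a ℓ₁ ℓ₂) (n p : ℕ) .{{_ : NonZero p}} where
  open Periods A n

  0<p : 0 < p
  0<p = >-nonZero⁻¹ p

  PMatch : Str A n → ℕ → Set ℓ₁
  PMatch t x = Match t x (x + p)

  record Maximal (t : Str A n) (i j : ℕ) : Set ℓ₁ where
    field
      long : i + p + p ≤ suc j
      periodic : HasPeriod t i j p
      -- c is i − 1, resp. j + 1 − p: extending t[i..j] by one letter keeps period p iff PMatch t c.
      maximalˡ : ∀ c → suc c ≡ i → ¬ PMatch t c
      maximalʳ : suc j < n → ∀ c → c + p ≡ suc j → ¬ PMatch t c

  private
    m+n<o⇒n<o∸m : ∀ {m n o} → m + n < o → n < o ∸ m
    m+n<o⇒n<o∸m {m} {n} {o} m+n<o = m+n≤o⇒m≤o∸n (suc n) (subst (_≤ o) (cong suc (+-comm m n)) m+n<o)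

    2p≡ : ∀ i → 2 * p + i ≡ i + p + p
    2p≡ i = solve (i ∷ p ∷ [])

  module _ {t : Str A n} {j : ℕ} (j<n : j < n) where

    run⇒maximal : ∀ {i} → IsPPeriodicRun A p t i j → Maximal t i j
    run⇒maximal {i} ((q , (q-period , q-least) , _ , runˡ , runʳ) , 2p≤ , p-period) = record
      { long = long
      ; periodic = isPeriod⇒hasPeriod p-period
      ; maximalˡ = λ { c refl c≈ → periodBelowMinPeriods (extendedˡ c refl c≈) (runˡ (s≤s z≤n)) }
      ; maximalʳ = λ sj<n c c+p≡ c≈ → periodBelowMinPeriods (extendedʳ c c+p≡ c≈) (runʳ sj<n)
      }
      where
      i≤1+j : i ≤ suc j
      i≤1+j = <⇒≤ (m∸n≢0⇒n<m λ len≡0 → <⇒≱ (*-monoʳ-< 2 0<p) (subst (2 * p ≤_) len≡0 2p≤))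
      long : i + p + p ≤ suc j
      long = subst (_≤ suc j) (2p≡ i) (m≤o∸n⇒m+n≤o (2 * p) i≤1+j 2p≤)
      0<q : 0 < q
      0<q = proj₁ q-period
      q≤p : q ≤ p
      q≤p = q-least p p-period
      long′ : i + p + q ≤ suc j
      long′ = ≤-trans (+-monoʳ-≤ (i + p) q≤p) long
      i+q≤j : i + q ≤ j
      i+q≤j = s≤s⁻¹ (≤-trans (+-monoʳ-≤ (suc i) q≤p) (≤-trans (m<m+n (i + p) 0<p) long))
      extendedˡ : ∀ c → suc c ≡ i → PMatch t c → IsPeriod A t c j q
      extendedˡ c refl c≈ = hasPeriod⇒isPeriod 0<q (m+n<o⇒n<o∸m (s≤s (≤-trans (n≤1+n (c + q)) i+q≤j)))
        (Equivalence.from (extendˡ-iff j<n long′ 0<q q≤p (isPeriod⇒hasPeriod p-period) (isPeriod⇒hasPeriod q-period)) c≈)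
      extendedʳ : ∀ c → c + p ≡ suc j → PMatch t c → IsPeriod A t i (suc j) q
      extendedʳ c c+p≡ c≈ = hasPeriod⇒isPeriod 0<q (m+n<o⇒n<o∸m (s≤s (m≤n⇒m≤1+n i+q≤j)))
        (Equivalence.from (extendʳ-iff j<n long′ 0<q q≤p c+p≡ (isPeriod⇒hasPeriod p-period) (isPeriod⇒hasPeriod q-period))
          (subst (Match t c) c+p≡ c≈))

    noShortPeriodˡ : ∀ {i q} → Maximal t i j → 1 ≤ i → IsPeriod A t (i ∸ 1) j q → p < q
    noShortPeriodˡ {suc c} {q} m _ q-period@(0<q , _) = ≰⇒> λ q≤p → maximalˡ c refl
      (Equivalence.to (extendˡ-iff j<n (≤-trans (+-monoʳ-≤ (suc c + p) q≤p) long) 0<q q≤p periodic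
                                   (hasPeriod-mono (n≤1+n c) ≤-refl (isPeriod⇒hasPeriod q-period)))
                      (isPeriod⇒hasPeriod q-period))
      where open Maximal m

    noShortPeriodʳ : ∀ {i q} → Maximal t i j → suc j < n → IsPeriod A t i (suc j) q → p < q
    noShortPeriodʳ {i} {q} m 1+j<n q-period@(0<q , _) = ≰⇒> λ q≤p → maximalʳ 1+j<n c c+p≡
      (subst (Match t c) (sym c+p≡)
        (Equivalence.to (extendʳ-iff j<n (≤-trans (+-monoʳ-≤ (i + p) q≤p) long) 0<q q≤p c+p≡ periodic
                                     (hasPeriod-mono ≤-refl (n≤1+n j) (isPeriod⇒hasPeriod q-period)))
                        (isPeriod⇒hasPeriod q-period)))
      where
      open Maximal m
      c : ℕ
      c = suc j ∸ p
      c+p≡ : c + p ≡ suc j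
      c+p≡ = m∸n+n≡m (≤-trans (m≤n+m p (i + p)) long)

    maximal⇒run : ∀ {i} → Maximal t i j → IsPPeriodicRun A p t i j
    maximal⇒run {i} m = (q , q-min , ≤-trans (*-monoʳ-≤ 2 q≤p) 2p≤ , runˡ , runʳ) , 2p≤ , p-period
      where
      open Maximal m
      2p≤ : 2 * p ≤ suc j ∸ i
      2p≤ = m+n≤o⇒m≤o∸n (2 * p) (subst (_≤ suc j) (sym (2p≡ i)) long)
      p-period : IsPeriod A t i j p
      p-period = hasPeriod⇒isPeriod 0<p (m+n<o⇒n<o∸m (≤-trans (m<m+n (i + p) 0<p) long)) periodic
      q : ℕ
      q = proj₁ (minPeriod p-period)
      q-min : IsMinPeriod A t i j q
      q-min = proj₂ (minPeriod p-period)
      q≤p : q ≤ p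
      q≤p = proj₂ q-min p p-period
      runˡ : 1 ≤ i → ∀ q′ → IsMinPeriod A t (i ∸ 1) j q′ → q < q′
      runˡ 1≤i q′ (q′-period , _) = ≤-<-trans q≤p (noShortPeriodˡ m 1≤i q′-period)
      runʳ : suc j < n → ∀ q′ → IsMinPeriod A t i (suc j) q′ → q < q′
      runʳ 1+j<n q′ (q′-period , _) = ≤-<-trans q≤p (noShortPeriodʳ m 1+j<n q′-period)

  maximal-transfer : ∀ {t₁ t₂ i j} → Maximal t₁ i j →
                     (∀ x → i ≤ suc x → x + p ≤ suc j → PMatch t₁ x ⇔ PMatch t₂ x) → Maximal t₂ i j
  maximal-transfer {i = i} {j} m agree = record
    { long = long
    ; periodic = λ x i≤x x+p≤j → Equivalence.to (agree x (m≤n⇒m≤1+n i≤x) (m≤n⇒m≤1+n x+p≤j)) (periodic x i≤x x+p≤j)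
    ; maximalˡ = λ c 1+c≡i → maximalˡ c 1+c≡i ∘ Equivalence.from (agree c (≤-reflexive (sym 1+c≡i)) (c+p≤1+j 1+c≡i))
    ; maximalʳ = λ 1+j<n c c+p≡ → maximalʳ 1+j<n c c+p≡ ∘ Equivalence.from (agree c (i≤1+c c+p≡) (≤-reflexive c+p≡))
    }
    where
    open Maximal m
    c+p≤1+j : ∀ {c} → suc c ≡ i → c + p ≤ suc j
    c+p≤1+j {c} 1+c≡i = ≤-trans (n≤1+n (c + p)) (≤-trans (m≤m+n (suc c + p) p) (subst (λ i → i + p + p ≤ suc j) (sym 1+c≡i) long))
    i≤1+c : ∀ {c} → c + p ≡ suc j → i ≤ suc c
    i≤1+c {c} c+p≡ = m≤n⇒m≤1+n (+-cancelʳ-≤ p i c (≤-trans (m≤m+n (i + p) p) (subst (i + p + p ≤_) (sym c+p≡) long)))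

module Scanning {a ℓ₁ ℓ₂ : Level} (A : StrictTotalOrder a ℓ₁ ℓ₂) (n p : ℕ) .{{_ : NonZero p}} where
  open StrictTotalOrder A using (_≈_; irrefl; module Eq) renaming (_<_ to _≺_)
  open Periods A n
  open PeriodicRuns A n p

  private
    m+p<n⇒m<n : ∀ {m} → m + p < n → m < n
    m+p<n⇒m<n {m} = ≤-<-trans (m≤m+n m p)

    ≺⇒¬pmatch : ∀ {t m} (m+p<n : m + p < n) → t (fromℕ< (m+p<n⇒m<n m+p<n)) ≺ t (fromℕ< m+p<n) → ¬ PMatch t m
    ≺⇒¬pmatch m+p<n lt match = irrefl (Equivalence.to (match⇔≈ (m+p<n⇒m<n m+p<n) m+p<n) match) lt

    ≻⇒¬pmatch : ∀ {t m} (m+p<n : m + p < n) → t (fromℕ< m+p<n) ≺ t (fromℕ< (m+p<n⇒m<n m+p<n)) → ¬ PMatch t m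
    ≻⇒¬pmatch m+p<n gt match = irrefl (Eq.sym (Equivalence.to (match⇔≈ (m+p<n⇒m<n m+p<n) m+p<n) match)) gt

    ≈⇒pmatch : ∀ {t m} (m+p<n : m + p < n) → t (fromℕ< (m+p<n⇒m<n m+p<n)) ≈ t (fromℕ< m+p<n) → PMatch t m
    ≈⇒pmatch m+p<n = Equivalence.from (match⇔≈ (m+p<n⇒m<n m+p<n) m+p<n)

  -- Continue with X on "=", stop at K on "<" or ">"; skipped when m + p is past the end,
  -- where PMatch holds vacuously.
  probe : ℕ → DTree n → DTree n → DTree n
  probe m K X with m + p <? n
  ... | yes m+p<n = node (fromℕ< (m+p<n⇒m<n m+p<n)) (fromℕ< m+p<n) K X K
  ... | no _ = X

  probes : List ℕ → DTree n → DTree n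
  probes [] K = K
  probes (m ∷ ms) K = probe m K (probes ms K)

  SameLeaf : DTree n → Str A n → Str A n → Set (a ⊔ ℓ₁ ⊔ ℓ₂)
  SameLeaf T t₁ t₂ = Σ (Leaf T) λ v → Reaches A t₁ T v × Reaches A t₂ T v

  module _ (t₁ t₂ : Str A n) where

    AgreeAlong : List ℕ → Set ℓ₁
    AgreeAlong [] = ⊤
    AgreeAlong (m ∷ ms) = (PMatch t₁ m ⇔ PMatch t₂ m) × (PMatch t₁ m → AgreeAlong ms)

    probe-outcome : ∀ m K X {v} → Reaches A t₁ (probe m K X) v → Reaches A t₂ (probe m K X) v →
                    (¬ PMatch t₁ m × ¬ PMatch t₂ m × SameLeaf K t₁ t₂) ⊎ (PMatch t₁ m × PMatch t₂ m × SameLeaf X t₁ t₂)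
    probe-outcome m K X r₁ r₂ with m + p <? n
    probe-outcome m K X (r-L ≺₁ r₁) (r-L ≺₂ r₂) | yes m+p<n =
      inj₁ (≺⇒¬pmatch m+p<n ≺₁ , ≺⇒¬pmatch m+p<n ≺₂ , _ , r₁ , r₂)
    probe-outcome m K X (r-E ≈₁ r₁) (r-E ≈₂ r₂) | yes m+p<n =
      inj₂ (≈⇒pmatch m+p<n ≈₁ , ≈⇒pmatch m+p<n ≈₂ , _ , r₁ , r₂)
    probe-outcome m K X (r-G ≻₁ r₁) (r-G ≻₂ r₂) | yes m+p<n =
      inj₁ (≻⇒¬pmatch m+p<n ≻₁ , ≻⇒¬pmatch m+p<n ≻₂ , _ , r₁ , r₂)
    probe-outcome m K X r₁ r₂ | no m+p≮n =
      inj₂ (match-outOfRange (≮⇒≥ m+p≮n) , match-outOfRange (≮⇒≥ m+p≮n) , _ , r₁ , r₂)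

    probes-agree : ∀ ms K {v} → Reaches A t₁ (probes ms K) v → Reaches A t₂ (probes ms K) v →
                   SameLeaf K t₁ t₂ × AgreeAlong ms
    probes-agree [] K r₁ r₂ = (_ , r₁ , r₂) , _
    probes-agree (m ∷ ms) K r₁ r₂ with probe-outcome m K (probes ms K) r₁ r₂
    ... | inj₁ (≉₁ , ≉₂ , same) = same , mk⇔ (⊥-elim ∘ ≉₁) (⊥-elim ∘ ≉₂) , ⊥-elim ∘ ≉₁
    ... | inj₂ (≈₁ , ≈₂ , _ , r₁′ , r₂′) = proj₁ rest , mk⇔ (λ _ → ≈₂) (λ _ → ≈₁) , λ _ → proj₂ rest
      where
      rest : SameLeaf K t₁ t₂ × AgreeAlong ms
      rest = probes-agree ms K r₁′ r₂′

    agreeAlong-downFrom : ∀ b e → AgreeAlong (downFrom b) → e < b →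
                          (∀ x → e < x → x < b → PMatch t₁ x) → PMatch t₁ e ⇔ PMatch t₂ e
    agreeAlong-downFrom (suc c) e (agree-c , rest) e<1+c matches with m≤n⇒m<n∨m≡n (s≤s⁻¹ e<1+c)
    ... | inj₂ refl = agree-c
    ... | inj₁ e<c = agreeAlong-downFrom c e (rest (matches c e<c ≤-refl)) e<c
                       λ x e<x x<c → matches x e<x (m<n⇒m<1+n x<c)

    agreeAlong-upFrom : ∀ s f e → AgreeAlong (iterate suc s f) → s ≤ e → e < s + f →
                        (∀ x → s ≤ x → x < e → PMatch t₁ x) → PMatch t₁ e ⇔ PMatch t₂ e
    agreeAlong-upFrom s zero e _ s≤e e<s+0 _ = contradiction (subst (e <_) (+-identityʳ s) e<s+0) (≤⇒≯ s≤e)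
    agreeAlong-upFrom s (suc f) e (agree-s , rest) s≤e e<s+1+f matches with m≤n⇒m<n∨m≡n s≤e
    ... | inj₂ refl = agree-s
    ... | inj₁ s<e = agreeAlong-upFrom (suc s) f e (rest (matches s ≤-refl s<e)) s<e
                       (subst (e <_) (+-suc s f) e<s+1+f) λ x s<x x<e → matches x (<⇒≤ s<x) x<e

  blocks : ℕ → DTree n
  blocks zero = leaf
  blocks (suc k) = probes (downFrom (k * p)) (probes (iterate suc (k * p) n) (blocks k))

  blocks-agree : ∀ t₁ t₂ K {v} → Reaches A t₁ (blocks K) v → Reaches A t₂ (blocks K) v → ∀ k → k < K →
                 AgreeAlong t₁ t₂ (downFrom (k * p)) × AgreeAlong t₁ t₂ (iterate suc (k * p) n)
  blocks-agree t₁ t₂ (suc K) r₁ r₂ k k<1+K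
    with probes-agree t₁ t₂ (downFrom (K * p)) _ r₁ r₂
  ... | (_ , r₁′ , r₂′) , leftward with probes-agree t₁ t₂ (iterate suc (K * p) n) _ r₁′ r₂′
  ... | (_ , r₁″ , r₂″) , rightward with m≤n⇒m<n∨m≡n (s≤s⁻¹ k<1+K)
  ...   | inj₂ refl = leftward , rightward
  ...   | inj₁ k<K = blocks-agree t₁ t₂ K r₁″ r₂″ k k<K

  probe-height : ∀ m K X → basicHeight X ≤ suc (basicHeight K) → basicHeight (probe m K X) ≤ suc (basicHeight K)
  probe-height m K X X-height with m + p <? n
  ... | yes _ = ⊔-lub ≤-refl (⊔-lub X-height ≤-refl)
  ... | no _ = X-height

  probes-height : ∀ ms K → basicHeight (probes ms K) ≤ suc (basicHeight K)
  probes-height [] K = n≤1+n _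
  probes-height (m ∷ ms) K = probe-height m K _ (probes-height ms K)

  blocks-height : ∀ k → basicHeight (blocks k) ≤ 2 * k
  blocks-height zero = z≤n
  blocks-height (suc k) = begin
    basicHeight (blocks (suc k))                                  ≤⟨ probes-height (downFrom (k * p)) _ ⟩
    suc (basicHeight (probes (iterate suc (k * p) n) (blocks k)))  ≤⟨ s≤s (probes-height (iterate suc (k * p) n) _) ⟩
    2 + basicHeight (blocks k)                                    ≤⟨ +-monoʳ-≤ 2 (blocks-height k) ⟩
    2 + 2 * k                                                     ≡⟨ *-suc 2 k ⟨
    2 * suc k                                                     ∎
    where open ≤-Reasoning

  blockStart : ∀ i → Σ ℕ λ k → i ≤ k * p × k * p < i + p
  blockStart zero = 0 , z≤n , 0<p
  blockStart (suc i) with blockStart i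
  ... | k , i≤kp , kp<i+p with m≤n⇒m<n∨m≡n i≤kp
  ...   | inj₁ i<kp = k , i<kp , m<n⇒m<1+n kp<i+p
  ...   | inj₂ refl = suc k , +-monoˡ-≤ (k * p) 0<p , s≤s (≤-reflexive (+-comm p (k * p)))

  blockInside : ∀ {i j} → i + p + p ≤ suc j → Σ ℕ λ k → i ≤ k * p × k * p + p ≤ j
  blockInside {i} long with blockStart i
  ... | k , i≤b , b<i+p = k , i≤b , s≤s⁻¹ (≤-trans (+-monoˡ-< p b<i+p) long)

  agreeOnWindow : ∀ {K t₁ t₂ v i j} → (∀ k → k * p + p ≤ n → k < K) →
                  Reaches A t₁ (blocks K) v → Reaches A t₂ (blocks K) v → j < n → i + p + p ≤ suc j → HasPeriod t₁ i j p →
                  ∀ x → i ≤ suc x → x + p ≤ suc j → PMatch t₁ x ⇔ PMatch t₂ x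
  agreeOnWindow {K} {t₁} {t₂} covers r₁ r₂ j<n long period x i≤1+x x+p≤1+j with blockInside long
  ... | k , i≤b , b+p≤j with blocks-agree t₁ t₂ K r₁ r₂ k (covers k (≤-trans b+p≤j (<⇒≤ j<n)))
  ...   | leftward , rightward with x <? k * p
  ...     | yes x<b = agreeAlong-downFrom t₁ t₂ (k * p) x leftward x<b
                        λ z x<z z<b → period z (≤-trans i≤1+x x<z) (<⇒≤ (<-≤-trans (+-monoˡ-< p z<b) b+p≤j))
  ...     | no x≮b = agreeAlong-upFrom t₁ t₂ (k * p) n x rightward (≮⇒≥ x≮b) x<b+n
                        λ z b≤z z<x → period z (≤-trans i≤b b≤z) (s≤s⁻¹ (≤-trans (+-monoˡ-< p z<x) x+p≤1+j))
    where
    x<b+n : x < k * p + n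
    x<b+n = ≤-trans (<-≤-trans (m<m+n x 0<p) (≤-trans x+p≤1+j j<n)) (m≤n+m n (k * p))

  blocks-findsRuns : ∀ {K} → (∀ k → k * p + p ≤ n → k < K) → FindsPPeriodicRuns A p (blocks K)
  blocks-findsRuns covers t₁ t₂ v r₁ r₂ i j = mk⇔ (transfer r₁ r₂) (transfer r₂ r₁)
    where
    j<n : toℕ j < n
    j<n = toℕ<n j
    transfer : ∀ {t t′} → Reaches A t _ v → Reaches A t′ _ v →
               IsPPeriodicRun A p t (toℕ i) (toℕ j) → IsPPeriodicRun A p t′ (toℕ i) (toℕ j)
    transfer r r′ run = maximal⇒run j<n (maximal-transfer m (agreeOnWindow covers r r′ j<n long periodic))
      where
      m : Maximal _ (toℕ i) (toℕ j)
      m = run⇒maximal j<n run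
      open Maximal m

⌈n/p⌉-covers : ∀ n p .{{_ : NonZero p}} k → k * p + p ≤ n → k < ⌈ n / p ⌉
⌈n/p⌉-covers n p k k*p+p≤n = begin
  suc k                 ≡⟨ m*n/n≡m (suc k) p ⟨
  suc k * p / p         ≤⟨ /-monoˡ-≤ p (begin
    suc k * p             ≡⟨ +-comm p (k * p) ⟩
    k * p + p             ≤⟨ k*p+p≤n ⟩
    n                     ≤⟨ m≤m+n n (p ∸ 1) ⟩
    n + (p ∸ 1)           ≡⟨ +-∸-assoc n (>-nonZero⁻¹ p) ⟨
    n + p ∸ 1             ∎) ⟩
  (n + p ∸ 1) / p       ∎
  where open ≤-Reasoning

lemma10 : ∀ {a ℓ₁ ℓ₂ : Level} (A : StrictTotalOrder a ℓ₁ ℓ₂) (n p : ℕ) → 0 < n → .{{_ : NonZero p}} →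
    Σ (DTree n) λ T → FindsPPeriodicRuns A p T × (basicHeight T ≤ 2 * ⌈ n / p ⌉)
lemma10 A n p _ = blocks ⌈ n / p ⌉ , blocks-findsRuns (⌈n/p⌉-covers n p) , blocks-height ⌈ n / p ⌉
  where open Scanning A n p
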